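{- Let $\ell,q_1,q_2,k_1,k_2$ be positive integers with $\ell\le k_1$ and $\ell\le k_2$, and set $\mathcal{E}_1=\mathcal{E}(q_1,k_1,\ell)$ and $\mathcal{E}_2=\mathcal{E}(q_2,k_2,\ell)$. Then \[\mathcal{E}(q_1q_2,\operatorname{lcm}(k_1,k_2),\ell)\geq\gcd(k_1,k_2)\,\mathcal{E}_1\,\mathcal{E}_2.\]
   Context: Let $q,k,\ell$ be positive integers with $\ell\le k$. A colouring of $n$ eBugs is an $n$-tuple of words $w_1,\dots,w_n\in\mathbb{Z}_q^k$ (positions read modulo $k$). It is $\ell$-valid if the $nk$ cyclic windows $(w_j(i),w_j(i+1),\dots,w_j(i+\ell-1))\in\mathbb{Z}_q^\ell$ (positions modulo $k$), for $1\le j\le n$ and $0\le i<k$, are pairwise distinct. The eBug number $\mathcal{E}(q,k,\ell)$ is the maximum $n$ for which an $\ell$-valid colouring of $n$ eBugs exists. -}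

module Defs where

open import Data.Nat using (ℕ; zero; suc; _+_; _≤_; _%_)
open import Data.Nat.DivMod using (m%n<n)
open import Data.Fin using (Fin; toℕ; fromℕ<)
open import Data.Vec using (Vec; tabulate)
open import Data.Product using (_×_; _,_; Σ)
open import Function.Definitions using (Injective)
open import Relation.Binary.PropositionalEquality using (_≡_)

Word : ℕ → ℕ → Set
Word q k = Fin k → Fin q

shift : ∀ {k} → Fin k → ℕ → Fin k
shift {zero} () t
shift {suc k} i t = fromℕ< (m%n<n (toℕ i + t) (suc k))

window : ∀ {q k} (ℓ : ℕ) → Word q k → Fin k → Vec (Fin q) ℓ
window ℓ w i = tabulate (λ t → w (shift i (toℕ t)))

Colouring : ℕ → ℕ → ℕ → Set
Colouring q k n = Fin n → Word q k

Valid : ∀ {q k n} (ℓ : ℕ) → Colouring q k n → Set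
Valid {q} {k} {n} ℓ c =
  Injective _≡_ _≡_ (λ (p : Fin n × Fin k) → window ℓ (c (Data.Product.proj₁ p)) (Data.Product.proj₂ p))

IsEBugNumber : ℕ → ℕ → ℕ → ℕ → Set
IsEBugNumber q k ℓ e =
  Σ (Colouring q k e) (Valid ℓ) ×
  (∀ n → (c : Colouring q k n) → Valid ℓ c → n ≤ e)

-- Superimpose the colourings coordinatewise on the common period L = lcm(k₁,k₂): a word
-- of length L is a pair of periodically extended words of lengths k₁ and k₂, and the second
-- one may be rotated by a phase s < g = gcd(k₁,k₂).  Its ℓ-windows are exactly the pairs of
-- ℓ-windows of the two components, at positions i mod k₁ and (s + i) mod k₂.  If two such
-- windows coincide, validity of the factors identifies the bugs and gives both congruences;
-- reducing them mod g (which divides k₁ and k₂) forces equal phases, and then the Chinese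
-- remainder uniqueness mod lcm(k₁,k₂) forces equal positions.  This yields g·𝓔₁·𝓔₂ bugs.
module Submission where

open import Defs
open import Data.Nat using (ℕ; _*_; _≤_)
open import Data.Nat.GCD using (gcd)
open import Data.Nat.LCM using (lcm)

open import Data.Nat.Base using (suc; _+_; _∸_; _<_; _%_; NonZero; ≢-nonZero; ≢-nonZero⁻¹; >-nonZero)
open import Data.Nat.Properties
  using (≤-total; +-assoc; +-comm; m*n≢0; m*n≢0⇒n≢0; m+[n∸m]≡n; [m+n]∸[m+o]≡n∸o; *-distribʳ-∸)
open import Data.Nat.DivMod
  using (_/_; _mod_; m%n<n; m≡m%n+[m/n]*n; m%n%n≡m%n; %-distribˡ-+; %-remove-+ʳ; m∣n⇒o%n%m≡o%m; m<n⇒m%n≡m)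
open import Data.Nat.Divisibility using (_∣_; divides)
open import Data.Nat.GCD using (gcd[m,n]∣m; gcd[m,n]∣n; gcd[m,n]≢0)
open import Data.Nat.LCM using (m∣lcm[m,n]; n∣lcm[m,n]; lcm-least; gcd*lcm)
open import Data.Fin.Base using (Fin; toℕ; combine; remQuot)
open import Data.Fin.Properties using (toℕ-fromℕ<; toℕ-injective; toℕ<n; combine-injective; *↔×)
open import Data.Vec.Base using (tabulate; lookup)
open import Data.Vec.Properties using (lookup∘tabulate; tabulate-cong)
open import Data.Product.Base using (_×_; _,_; proj₁; proj₂; map₁)
open import Data.Sum.Base using (inj₁; inj₂)
open import Function.Base using (_∘_)
open import Function.Bundles using (Injection)
open import Function.Definitions using (Injective)
open import Function.Properties.Inverse using (↔⇒↣)
open import Relation.Binary.PropositionalEquality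
  using (_≡_; refl; sym; trans; cong; cong₂; subst; module ≡-Reasoning)

gcd-nonZero : ∀ m n .{{_ : NonZero m}} → NonZero (gcd m n)
gcd-nonZero m n = ≢-nonZero (gcd[m,n]≢0 m n (inj₁ (≢-nonZero⁻¹ m)))

lcm-nonZero : ∀ m n .{{_ : NonZero m}} .{{_ : NonZero n}} → NonZero (lcm m n)
lcm-nonZero m n = m*n≢0⇒n≢0 (gcd m n) {{subst NonZero (sym (gcd*lcm m n)) (m*n≢0 m n)}}

shift≡mod : ∀ {k} .{{_ : NonZero k}} (i : Fin k) t → shift i t ≡ (toℕ i + t) mod k
shift≡mod {suc _} i t = refl

module _ {d : ℕ} .{{_ : NonZero d}} where

  %≡%⇒∣∸ : ∀ m n → m % d ≡ n % d → d ∣ m ∸ n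
  %≡%⇒∣∸ m n eq = divides (m / d ∸ n / d) (begin
    m ∸ n                                      ≡⟨ cong₂ _∸_ (m≡m%n+[m/n]*n m d) (m≡m%n+[m/n]*n n d) ⟩
    (m % d + m / d * d) ∸ (n % d + n / d * d)  ≡⟨ cong (λ r → (r + m / d * d) ∸ (n % d + n / d * d)) eq ⟩
    (n % d + m / d * d) ∸ (n % d + n / d * d)  ≡⟨ [m+n]∸[m+o]≡n∸o (n % d) _ _ ⟩
    m / d * d ∸ n / d * d                      ≡⟨ *-distribʳ-∸ d (m / d) (n / d) ⟨
    (m / d ∸ n / d) * d                        ∎)
    where open ≡-Reasoning

  ≤∧∣∸⇒%≡% : ∀ {m n} → m ≤ n → d ∣ n ∸ m → m % d ≡ n % d
  ≤∧∣∸⇒%≡% {m} m≤n d∣n∸m = trans (sym (%-remove-+ʳ m d∣n∸m)) (cong (_% d) (m+[n∸m]≡n m≤n))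

  ∣∸⇒%≡% : ∀ m n → d ∣ m ∸ n → d ∣ n ∸ m → m % d ≡ n % d
  ∣∸⇒%≡% m n d∣m∸n d∣n∸m with ≤-total m n
  ... | inj₁ m≤n = ≤∧∣∸⇒%≡% m≤n d∣n∸m
  ... | inj₂ n≤m = sym (≤∧∣∸⇒%≡% n≤m d∣m∸n)

  %≡%-+ : ∀ {a b c e} → a % d ≡ b % d → c % d ≡ e % d → (a + c) % d ≡ (b + e) % d
  %≡%-+ {a} {b} {c} {e} a≡b c≡e = begin
    (a + c) % d            ≡⟨ %-distribˡ-+ a c d ⟩
    (a % d + c % d) % d    ≡⟨ cong₂ (λ x y → (x + y) % d) a≡b c≡e ⟩
    (b % d + e % d) % d    ≡⟨ %-distribˡ-+ b e d ⟨
    (b + e) % d            ∎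
    where open ≡-Reasoning

  %≡%-cancel-+ˡ : ∀ r {m n} → (r + m) % d ≡ (r + n) % d → m % d ≡ n % d
  %≡%-cancel-+ˡ r {m} {n} eq = ∣∸⇒%≡% m n
    (subst (d ∣_) ([m+n]∸[m+o]≡n∸o r m n) (%≡%⇒∣∸ (r + m) (r + n) eq))
    (subst (d ∣_) ([m+n]∸[m+o]≡n∸o r n m) (%≡%⇒∣∸ (r + n) (r + m) (sym eq)))

  %≡%⇒≡ : ∀ {m n} → m < d → n < d → m % d ≡ n % d → m ≡ n
  %≡%⇒≡ m<d n<d eq = trans (sym (m<n⇒m%n≡m m<d)) (trans eq (m<n⇒m%n≡m n<d))

  toℕ-mod : ∀ m → toℕ (m mod d) ≡ m % d
  toℕ-mod m = toℕ-fromℕ< (m%n<n m d)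

  mod≡mod⇒%≡% : ∀ {m n} → m mod d ≡ n mod d → m % d ≡ n % d
  mod≡mod⇒%≡% {m} {n} eq = trans (sym (toℕ-mod m)) (trans (cong toℕ eq) (toℕ-mod n))

  toℕ-shift : ∀ (i : Fin d) t → toℕ (shift i t) ≡ (toℕ i + t) % d
  toℕ-shift i t = trans (cong toℕ (shift≡mod i t)) (toℕ-mod (toℕ i + t))

module _ {d n : ℕ} .{{_ : NonZero d}} .{{_ : NonZero n}} (d∣n : d ∣ n) where

  %≡%-∣ : ∀ {a b} → a % n ≡ b % n → a % d ≡ b % d
  %≡%-∣ {a} {b} eq = trans (sym (m∣n⇒o%n%m≡o%m d n a d∣n)) (trans (cong (_% d) eq) (m∣n⇒o%n%m≡o%m d n b d∣n))

  [s+[i+t]%n]%d≡[[s+i]%d+t]%d : ∀ s i t → (s + (i + t) % n) % d ≡ ((s + i) % d + t) % d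
  [s+[i+t]%n]%d≡[[s+i]%d+t]%d s i t = begin
    (s + (i + t) % n) % d   ≡⟨ %≡%-+ {a = s} refl (m∣n⇒o%n%m≡o%m d n (i + t) d∣n) ⟩
    (s + (i + t)) % d       ≡⟨ cong (_% d) (+-assoc s i t) ⟨
    (s + i + t) % d         ≡⟨ %≡%-+ (m%n%n≡m%n (s + i) d) refl ⟨
    ((s + i) % d + t) % d   ∎
    where open ≡-Reasoning

_⊗_ : ∀ {q₁ q₂ k} → Word q₁ k → Word q₂ k → Word (q₁ * q₂) k
(u ⊗ w) x = combine (u x) (w x)

extend : ∀ {q k L} .{{_ : NonZero k}} → ℕ → Word q k → Word q L
extend {k = k} s w x = w ((s + toℕ x) mod k)

tabulate-injective : ∀ {A : Set} {n} {f g : Fin n → A} → tabulate f ≡ tabulate g → ∀ t → f t ≡ g t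
tabulate-injective {f = f} {g} eq t =
  trans (sym (lookup∘tabulate f t)) (trans (cong (λ v → lookup v t) eq) (lookup∘tabulate g t))

window-⊗-injective : ∀ {q₁ q₂ k} ℓ (u u' : Word q₁ k) (w w' : Word q₂ k) {i i' : Fin k} →
  window ℓ (u ⊗ w) i ≡ window ℓ (u' ⊗ w') i' →
  window ℓ u i ≡ window ℓ u' i' × window ℓ w i ≡ window ℓ w' i'
window-⊗-injective ℓ _ _ _ _ eq = tabulate-cong (proj₁ ∘ pointwise) , tabulate-cong (proj₂ ∘ pointwise)
  where pointwise = λ t → combine-injective _ _ _ _ (tabulate-injective eq t)

module _ {q k L : ℕ} .{{_ : NonZero k}} .{{_ : NonZero L}} (k∣L : k ∣ L) (ℓ : ℕ) where

  window-extend : ∀ s (w : Word q k) (i : Fin L) →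
    window ℓ (extend s w) i ≡ window ℓ w ((s + toℕ i) mod k)
  window-extend s w i = tabulate-cong (λ t → cong w (toℕ-injective (begin
    toℕ ((s + toℕ (shift i (toℕ t))) mod k)   ≡⟨ toℕ-mod _ ⟩
    (s + toℕ (shift i (toℕ t))) % k           ≡⟨ cong (λ x → (s + x) % k) (toℕ-shift i (toℕ t)) ⟩
    (s + (toℕ i + toℕ t) % L) % k             ≡⟨ [s+[i+t]%n]%d≡[[s+i]%d+t]%d k∣L s (toℕ i) (toℕ t) ⟩
    ((s + toℕ i) % k + toℕ t) % k             ≡⟨ cong (λ x → (x + toℕ t) % k) (toℕ-mod _) ⟨
    (toℕ ((s + toℕ i) mod k) + toℕ t) % k     ≡⟨ toℕ-shift _ (toℕ t) ⟨
    toℕ (shift ((s + toℕ i) mod k) (toℕ t))   ∎)))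
    where open ≡-Reasoning

  window-extend-≡ : ∀ s s' (w w' : Word q k) (i i' : Fin L) →
    window ℓ (extend s w) i ≡ window ℓ (extend s' w') i' →
    window ℓ w ((s + toℕ i) mod k) ≡ window ℓ w' ((s' + toℕ i') mod k)
  window-extend-≡ s s' w w' i i' eq =
    trans (sym (window-extend s w i)) (trans eq (window-extend s' w' i'))

WindowsDistinct : ∀ {I : Set} {q k} (ℓ : ℕ) → (I → Word q k) → Set
WindowsDistinct {I} {k = k} ℓ c = Injective _≡_ _≡_ (λ (p : I × Fin k) → window ℓ (c (proj₁ p)) (proj₂ p))

WindowsDistinct-∘ : ∀ {I J : Set} {q k ℓ} {c : I → Word q k} {f : J → I} →
  Injective _≡_ _≡_ f → WindowsDistinct ℓ c → WindowsDistinct ℓ (c ∘ f)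
WindowsDistinct-∘ f-injective c-distinct eq =
  cong₂ _,_ (f-injective (cong proj₁ (c-distinct eq))) (cong proj₂ (c-distinct eq))

remQuot-injective : ∀ {m} n → Injective _≡_ _≡_ (remQuot {m} n)
remQuot-injective {m} n = Injection.injective (↔⇒↣ (*↔× {m} {n}))

module _ {k₁ k₂ : ℕ} .{{_ : NonZero k₁}} .{{_ : NonZero k₂}} where

  private instance
    gcd≢0 : NonZero (gcd k₁ k₂)
    gcd≢0 = gcd-nonZero k₁ k₂
    lcm≢0 : NonZero (lcm k₁ k₂)
    lcm≢0 = lcm-nonZero k₁ k₂

  %≡%-lcm : ∀ {m n} → m % k₁ ≡ n % k₁ → m % k₂ ≡ n % k₂ → m % lcm k₁ k₂ ≡ n % lcm k₁ k₂
  %≡%-lcm {m} {n} eq₁ eq₂ = ∣∸⇒%≡% m n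
    (lcm-least (%≡%⇒∣∸ m n eq₁) (%≡%⇒∣∸ m n eq₂))
    (lcm-least (%≡%⇒∣∸ n m (sym eq₁)) (%≡%⇒∣∸ n m (sym eq₂)))

  phase-position-unique : ∀ {s s' i i'} → s < gcd k₁ k₂ → s' < gcd k₁ k₂ → i < lcm k₁ k₂ → i' < lcm k₁ k₂ →
    i % k₁ ≡ i' % k₁ → (s + i) % k₂ ≡ (s' + i') % k₂ → s ≡ s' × i ≡ i'
  phase-position-unique {s} {s'} {i} {i'} s< s'< i< i'< eq₁ eq₂ = s≡s' , i≡i'
    where
    open ≡-Reasoning
    s≡s' : s ≡ s'
    s≡s' = %≡%⇒≡ s< s'< (%≡%-cancel-+ˡ {d = gcd k₁ k₂} i' (begin
      (i' + s) % gcd k₁ k₂   ≡⟨ cong (_% gcd k₁ k₂) (+-comm i' s) ⟩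
      (s + i') % gcd k₁ k₂   ≡⟨ %≡%-+ {d = gcd k₁ k₂} {a = s} refl (%≡%-∣ (gcd[m,n]∣m k₁ k₂) eq₁) ⟨
      (s + i) % gcd k₁ k₂    ≡⟨ %≡%-∣ (gcd[m,n]∣n k₁ k₂) eq₂ ⟩
      (s' + i') % gcd k₁ k₂  ≡⟨ cong (_% gcd k₁ k₂) (+-comm s' i') ⟩
      (i' + s') % gcd k₁ k₂  ∎))
    i≡i' : i ≡ i'
    i≡i' = %≡%⇒≡ i< i'< (%≡%-lcm eq₁ (%≡%-cancel-+ˡ s
      (subst (λ x → (s + i) % k₂ ≡ (x + i') % k₂) (sym s≡s') eq₂)))

  module _ {q₁ q₂ e₁ e₂ : ℕ} where

    superimpose : Colouring q₁ k₁ e₁ → Colouring q₂ k₂ e₂ →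
      (Fin (gcd k₁ k₂) × Fin e₁) × Fin e₂ → Word (q₁ * q₂) (lcm k₁ k₂)
    superimpose c₁ c₂ ((s , a) , b) = extend 0 (c₁ a) ⊗ extend (toℕ s) (c₂ b)

    superimpose-distinct : ∀ ℓ (c₁ : Colouring q₁ k₁ e₁) (c₂ : Colouring q₂ k₂ e₂) →
      Valid ℓ c₁ → Valid ℓ c₂ → WindowsDistinct ℓ (superimpose c₁ c₂)
    superimpose-distinct ℓ c₁ c₂ v₁ v₂ {((s , a) , b) , i} {((s' , a') , b') , i'} eq =
      cong₂ _,_ (cong₂ _,_ (cong₂ _,_ (toℕ-injective (proj₁ pos)) (cong proj₁ bug₁)) (cong proj₁ bug₂))
                (toℕ-injective (proj₂ pos))
      where
      windows = window-⊗-injective ℓ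
        (extend 0 (c₁ a)) (extend 0 (c₁ a')) (extend (toℕ s) (c₂ b)) (extend (toℕ s') (c₂ b')) eq
      bug₁ = v₁ (window-extend-≡ (m∣lcm[m,n] k₁ k₂) ℓ 0 0 (c₁ a) (c₁ a') i i' (proj₁ windows))
      bug₂ = v₂ (window-extend-≡ (n∣lcm[m,n] k₁ k₂) ℓ (toℕ s) (toℕ s') (c₂ b) (c₂ b') i i' (proj₂ windows))
      pos = phase-position-unique (toℕ<n s) (toℕ<n s') (toℕ<n i) (toℕ<n i')
        (mod≡mod⇒%≡% (cong proj₂ bug₁)) (mod≡mod⇒%≡% (cong proj₂ bug₂))

    unpack : Fin (gcd k₁ k₂ * e₁ * e₂) → (Fin (gcd k₁ k₂) × Fin e₁) × Fin e₂
    unpack = map₁ (remQuot e₁) ∘ remQuot e₂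

    unpack-injective : Injective _≡_ _≡_ unpack
    unpack-injective eq =
      remQuot-injective e₂ (cong₂ _,_ (remQuot-injective e₁ (cong proj₁ eq)) (cong proj₂ eq))

    superimposedColouring : Colouring q₁ k₁ e₁ → Colouring q₂ k₂ e₂ →
      Colouring (q₁ * q₂) (lcm k₁ k₂) (gcd k₁ k₂ * e₁ * e₂)
    superimposedColouring c₁ c₂ = superimpose c₁ c₂ ∘ unpack

    superimposedColouring-valid : ∀ ℓ (c₁ : Colouring q₁ k₁ e₁) (c₂ : Colouring q₂ k₂ e₂) →
      Valid ℓ c₁ → Valid ℓ c₂ → Valid ℓ (superimposedColouring c₁ c₂)
    superimposedColouring-valid ℓ c₁ c₂ v₁ v₂ =
      WindowsDistinct-∘ {c = superimpose c₁ c₂} unpack-injective (superimpose-distinct ℓ c₁ c₂ v₁ v₂)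

theorem2 : (ℓ q₁ q₂ k₁ k₂ : ℕ) → 1 ≤ ℓ → 1 ≤ q₁ → 1 ≤ q₂ → 1 ≤ k₁ → 1 ≤ k₂ →
    ℓ ≤ k₁ → ℓ ≤ k₂ →
    (e₁ e₂ e : ℕ) →
    IsEBugNumber q₁ k₁ ℓ e₁ → IsEBugNumber q₂ k₂ ℓ e₂ →
    IsEBugNumber (q₁ * q₂) (lcm k₁ k₂) ℓ e →
    gcd k₁ k₂ * e₁ * e₂ ≤ e
theorem2 ℓ _ _ k₁ k₂ _ _ _ 0<k₁ 0<k₂ _ _ _ _ _ ((c₁ , v₁) , _) ((c₂ , v₂) , _) (_ , maximal) =
  maximal _ (superimposedColouring c₁ c₂) (superimposedColouring-valid ℓ c₁ c₂ v₁ v₂)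
  where
  instance
    k₁≢0 : NonZero k₁
    k₁≢0 = >-nonZero 0<k₁
    k₂≢0 : NonZero k₂
    k₂≢0 = >-nonZero 0<k₂
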